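{- For every formula $A$ of $\mathcal{L}(\forall,\Box)$ there is a conjunctive form $F$ such that $A\leftrightarrow F\in\mathsf{FOL\Box}$.
   Context: Language $\mathcal{L}(\forall,\Box)$: first-order language with identity $=$, predicate symbols, variables, no constants or function symbols, connectives $\neg,\to$, quantifier $\forall$, modal operator $\Box$ (arbitrary nesting); other connectives defined as usual, $\Diamond:=\neg\Box\neg$. A formula is $\Box$-free if it contains no $\Box$. $\mathsf{FOL}$ is the set of $\Box$-free theses of classical first-order logic with identity. An occurrence of $x$ in $A$ is $\forall\Box$-bound if it is in the scope of a quantifier on $x$ or inside the scope of some $\Box$; otherwise $\forall\Box$-free. $x$ is a $\forall\Box$-free variable of $A$ if it has a $\forall\Box$-free occurrence. $A(^y/_x)$ is the simultaneous replacement of every $\forall\Box$-free occurrence of $x$ by $y$, provided $y$ is not captured by a quantifier. $\mathsf{FOL\Box}$ is the smallest set of formulas containing all instances of propositional tautologies and all instances of: $\Box(A\to B)\to(\Box A\to\Box B)$; $\Box A\to A$; $\neg\Box A\to\Box\neg\Box A$; $\forall xA\to A(^y/_x)$ (admissible $\forall\Box$-free substitution); $\forall x(A\to B)\to(A\to\forall xB)$ if $x$ is not $\forall\Box$-free in $A$; $x=x$; $x=y\wedge A(x)\to A(y)$ for $\Box$-free $A$ (usual first-order identity axiom); $\Box A\to\forall xA$; $\neg\Box A$ for every $\Box$-free $A\notin\mathsf{FOL}$; closed under: $A\in\mathsf{FOL\Box}\Rightarrow\Box A\in\mathsf{FOL\Box}$, and modus ponens. An elementary disjunction is a formula $A\vee\Diamond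 B\vee\Box C_1\vee\dots\vee\Box C_n$ with $A,B,C_1,\dots,C_n$ $\Box$-free. A conjunctive form is a conjunction of elementary disjunctions. -}

module Defs where

open import Data.Nat using (ℕ; _≟_)
open import Data.Bool using (Bool; true; false; not; _∨_; if_then_else_)
open import Data.List using (List; []; _∷_; map)
open import Data.List.NonEmpty using (List⁺; _∷_)
open import Data.List.Membership.Propositional using (_∈_)
open import Data.Product using (_×_)
open import Data.Sum using (_⊎_)
open import Data.Unit using (⊤)
open import Data.Empty using (⊥)
open import Relation.Nullary using (¬_; does)
open import Relation.Binary.PropositionalEquality using (_≡_; _≢_)

Var : Set
Var = ℕ

data Formula : Set where
  pred : ℕ → List Var → Formula
  _≐_  : Var → Var → Formula
  ¬'_  : Formula → Formula
  _⇒_  : Formula → Formula → Formula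
  ∀'   : Var → Formula → Formula
  □_   : Formula → Formula

infixr 5 _⇒_

_∨'_ : Formula → Formula → Formula
A ∨' B = (¬' A) ⇒ B

_∧'_ : Formula → Formula → Formula
A ∧' B = ¬' (A ⇒ ¬' B)

_⇔_ : Formula → Formula → Formula
A ⇔ B = (A ⇒ B) ∧' (B ⇒ A)

◇_ : Formula → Formula
◇ A = ¬' (□ (¬' A))

BoxFree : Formula → Set
BoxFree (pred _ _) = ⊤
BoxFree (_ ≐ _)    = ⊤
BoxFree (¬' A)     = BoxFree A
BoxFree (A ⇒ B)    = BoxFree A × BoxFree B
BoxFree (∀' _ A)   = BoxFree A
BoxFree (□ _)      = ⊥

FreeIn : Var → Formula → Set
FreeIn x (pred _ xs) = x ∈ xs
FreeIn x (y ≐ z)     = (x ≡ y) ⊎ (x ≡ z)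
FreeIn x (¬' A)      = FreeIn x A
FreeIn x (A ⇒ B)     = FreeIn x A ⊎ FreeIn x B
FreeIn x (∀' y A)    = (x ≢ y) × FreeIn x A
FreeIn x (□ _)       = ⊥

rn : Var → Var → Var → Var
rn y x z = if does (z ≟ x) then y else z

sub : Var → Var → Formula → Formula
sub y x (pred P xs) = pred P (map (rn y x) xs)
sub y x (u ≐ v)     = rn y x u ≐ rn y x v
sub y x (¬' A)      = ¬' sub y x A
sub y x (A ⇒ B)     = sub y x A ⇒ sub y x B
sub y x (∀' z A)    = if does (z ≟ x) then ∀' z A else ∀' z (sub y x A)
sub y x (□ A)       = □ A

Admissible : Var → Var → Formula → Set
Admissible y x (pred _ _) = ⊤
Admissible y x (_ ≐ _)    = ⊤
Admissible y x (¬' A)     = Admissible y x A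
Admissible y x (A ⇒ B)    = Admissible y x A × Admissible y x B
Admissible y x (∀' z A)   = (FreeIn x (∀' z A) → z ≢ y) × Admissible y x A
Admissible y x (□ _)      = ⊤

-- Propositional tautologies (instances): true under every Boolean
-- valuation of the formulas, where ¬ and → are read truth-functionally
-- and all other formulas (atoms, ∀xA, □A) are treated as atoms.

eval : (Formula → Bool) → Formula → Bool
eval v (¬' A)   = not (eval v A)
eval v (A ⇒ B)  = not (eval v A) ∨ eval v B
eval v A        = v A

Taut : Formula → Set
Taut A = (v : Formula → Bool) → eval v A ≡ true

data FOLDer : Formula → Set where
  taut    : ∀ {A} → BoxFree A → Taut A → FOLDer A
  ax-inst : ∀ {A x y} → BoxFree A → Admissible y x A →
            FOLDer (∀' x A ⇒ sub y x A)
  ax-dist : ∀ {A B x} → BoxFree A → BoxFree B → ¬ FreeIn x A →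
            FOLDer (∀' x (A ⇒ B) ⇒ (A ⇒ ∀' x B))
  ax-refl : ∀ {x} → FOLDer (x ≐ x)
  ax-id   : ∀ {A x y} → BoxFree A → Admissible y x A →
            FOLDer (((x ≐ y) ∧' A) ⇒ sub y x A)
  mp      : ∀ {A B} → FOLDer (A ⇒ B) → FOLDer A → FOLDer B
  gen     : ∀ {A x} → FOLDer A → FOLDer (∀' x A)

InFOL : Formula → Set
InFOL A = BoxFree A × FOLDer A

data FOL□ : Formula → Set where
  taut    : ∀ {A} → Taut A → FOL□ A
  ax-K    : ∀ {A B} → FOL□ (□ (A ⇒ B) ⇒ (□ A ⇒ □ B))
  ax-T    : ∀ {A} → FOL□ (□ A ⇒ A)
  ax-5    : ∀ {A} → FOL□ (¬' (□ A) ⇒ □ (¬' (□ A)))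
  ax-inst : ∀ {A x y} → Admissible y x A → FOL□ (∀' x A ⇒ sub y x A)
  ax-dist : ∀ {A B x} → ¬ FreeIn x A →
            FOL□ (∀' x (A ⇒ B) ⇒ (A ⇒ ∀' x B))
  ax-refl : ∀ {x} → FOL□ (x ≐ x)
  ax-id   : ∀ {A x y} → BoxFree A → Admissible y x A →
            FOL□ (((x ≐ y) ∧' A) ⇒ sub y x A)
  ax-□∀   : ∀ {A x} → FOL□ (□ A ⇒ ∀' x A)
  ax-¬□   : ∀ {A} → BoxFree A → ¬ InFOL A → FOL□ (¬' (□ A))
  nec     : ∀ {A} → FOL□ A → FOL□ (□ A)
  mp      : ∀ {A B} → FOL□ (A ⇒ B) → FOL□ A → FOL□ B

record ElemDisj : Set where
  field
    a  : Formula
    b  : Formula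
    cs : List Formula
    a-bf  : BoxFree a
    b-bf  : BoxFree b
    cs-bf : ∀ {c} → c ∈ cs → BoxFree c

boxDisj : Formula → List Formula → Formula
boxDisj acc []       = acc
boxDisj acc (c ∷ cs) = boxDisj (acc ∨' (□ c)) cs

-- A ∨ ◇B ∨ □C₁ ∨ … ∨ □Cₙ  (left-associated)
⟦_⟧ᴱ : ElemDisj → Formula
⟦ e ⟧ᴱ = boxDisj (ElemDisj.a e ∨' (◇ ElemDisj.b e)) (ElemDisj.cs e)

ConjForm : Set
ConjForm = List⁺ ElemDisj

conj : Formula → List ElemDisj → Formula
conj acc []       = acc
conj acc (e ∷ es) = conj (acc ∧' ⟦ e ⟧ᴱ) es

⟦_⟧ᶜ : ConjForm → Formula
⟦ e ∷ es ⟧ᶜ = conj ⟦ e ⟧ᴱ es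

-- Two elementary
-- disjunctions merge into one because ◇ distributes over ∨, so ∨ distributes
-- over conjunctive forms; the negation of A ∨ ◇B ∨ □C₁ ∨ … ∨ □Cₙ is the
-- conjunction of ¬A, □¬B and the ◇¬Cᵢ. The modal part ◇B ∨ □C₁ ∨ … ∨ □Cₙ has
-- no ∀□-free variables and, by S5, implies its own necessity, as does its
-- negation; hence ∀x(A ∨ R) ↔ ∀xA ∨ R and □(A ∨ R) ↔ □A ∨ R, and as ∀x and □
-- also distribute over ∧, both map conjunctive forms to conjunctive forms.
-- The purely propositional steps are instances of truth-table tautologies.
module Submission where

open import Defs
open import Data.Bool using (Bool; true; false; not; _∨_; _∧_; T; if_then_else_)
open import Data.Bool.Properties using (T-∧; T-≡)
open import Data.Fin using (Fin; zero; suc)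
open import Data.List using (List; []; _∷_; map; _++_; cartesianProductWith)
open import Data.List.NonEmpty using (_∷_)
open import Data.List.Membership.Propositional using (_∈_)
open import Data.List.Membership.Propositional.Properties using (∈-++⁻)
open import Data.List.Properties using (map-id; map-cong)
open import Data.List.Relation.Unary.Any using (here; there)
open import Data.Nat using (ℕ; zero; suc; _+_; _≟_)
open import Data.Product using (Σ; _,_; _×_; proj₁; proj₂)
open import Data.Sum using (inj₁; inj₂; [_,_]′)
open import Data.Unit using (tt)
open import Data.Vec as Vec using (Vec; _∷_; lookup)
open import Data.Vec.Properties using (lookup-map)
open import Function using (_∘_; Equivalence)
open import Relation.Nullary using (¬_; Dec; yes; no; does)
open import Relation.Binary.PropositionalEquality

⊢_ : Formula → Set
⊢_ = FOL□

infix 1 ⊢_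

-- Any fixed tautology serves as the constant ⊤.
⊤' : Formula
⊤' = pred 0 [] ⇒ pred 0 []

⊥' : Formula
⊥' = ¬' ⊤'

-- Propositional schemas, decided by truth tables

data Schema (n : ℕ) : Set where
  var  : Fin n → Schema n
  ⊤ˢ   : Schema n
  ¬ˢ_  : Schema n → Schema n
  _⇒ˢ_ : Schema n → Schema n → Schema n

_∨ˢ_ _∧ˢ_ _⇔ˢ_ : ∀ {n} → Schema n → Schema n → Schema n
φ ∨ˢ ψ = ¬ˢ φ ⇒ˢ ψ
φ ∧ˢ ψ = ¬ˢ (φ ⇒ˢ ¬ˢ ψ)
φ ⇔ˢ ψ = (φ ⇒ˢ ψ) ∧ˢ (ψ ⇒ˢ φ)

⊥ˢ : ∀ {n} → Schema n
⊥ˢ = ¬ˢ ⊤ˢ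

infix  9 ¬ˢ_
infixr 7 _∧ˢ_
infixr 6 _∨ˢ_
infixr 5 _⇒ˢ_
infix  4 _⇔ˢ_

x₀ : ∀ {n} → Schema (1 + n)
x₀ = var zero

x₁ : ∀ {n} → Schema (2 + n)
x₁ = var (suc zero)

x₂ : ∀ {n} → Schema (3 + n)
x₂ = var (suc (suc zero))

x₃ : ∀ {n} → Schema (4 + n)
x₃ = var (suc (suc (suc zero)))

x₄ : ∀ {n} → Schema (5 + n)
x₄ = var (suc (suc (suc (suc zero))))

x₅ : ∀ {n} → Schema (6 + n)
x₅ = var (suc (suc (suc (suc (suc zero)))))

instantiate : ∀ {n} → Vec Formula n → Schema n → Formula
instantiate σ (var i)  = lookup σ i
instantiate σ ⊤ˢ       = ⊤'
instantiate σ (¬ˢ φ)   = ¬' instantiate σ φ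
instantiate σ (φ ⇒ˢ ψ) = instantiate σ φ ⇒ instantiate σ ψ

⟦_⟧ˢ : ∀ {n} → Schema n → Vec Bool n → Bool
⟦ var i ⟧ˢ  ρ = lookup ρ i
⟦ ⊤ˢ ⟧ˢ     ρ = true
⟦ ¬ˢ φ ⟧ˢ   ρ = not (⟦ φ ⟧ˢ ρ)
⟦ φ ⇒ˢ ψ ⟧ˢ ρ = not (⟦ φ ⟧ˢ ρ) ∨ ⟦ ψ ⟧ˢ ρ

eval-⊤' : ∀ v → eval v ⊤' ≡ true
eval-⊤' v with v (pred 0 [])
... | true  = refl
... | false = refl

eval-instantiate : ∀ {n} v (σ : Vec Formula n) φ →
                   eval v (instantiate σ φ) ≡ ⟦ φ ⟧ˢ (Vec.map (eval v) σ)
eval-instantiate v σ (var i)  = sym (lookup-map i (eval v) σ)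
eval-instantiate v σ ⊤ˢ       = eval-⊤' v
eval-instantiate v σ (¬ˢ φ)   = cong not (eval-instantiate v σ φ)
eval-instantiate v σ (φ ⇒ˢ ψ) =
  cong₂ (λ p q → not p ∨ q) (eval-instantiate v σ φ) (eval-instantiate v σ ψ)

allValuations : ∀ n → (Vec Bool n → Bool) → Bool
allValuations zero    f = f Vec.[]
allValuations (suc n) f =
  allValuations n (f ∘ (true ∷_)) ∧ allValuations n (f ∘ (false ∷_))

allValuations-sound : ∀ n f → T (allValuations n f) → ∀ ρ → T (f ρ)
allValuations-sound zero    f ok Vec.[]      = ok
allValuations-sound (suc n) f ok (true ∷ ρ)  =
  allValuations-sound n _ (proj₁ (Equivalence.to T-∧ ok)) ρ
allValuations-sound (suc n) f ok (false ∷ ρ) =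
  allValuations-sound n _ (proj₂ (Equivalence.to T-∧ ok)) ρ

-- ∀ⁱ P quantifies over the entries of σ as implicit arguments, so that the
-- instance of a schema is found by unification at the use site.
∀ⁱ : ∀ {n} → (Vec Formula n → Set) → Set
∀ⁱ {zero}  P = P Vec.[]
∀ⁱ {suc n} P = ∀ {X} → ∀ⁱ (λ σ → P (X ∷ σ))

curryⁱ : ∀ n {P : Vec Formula n → Set} → (∀ σ → P σ) → ∀ⁱ P
curryⁱ zero    f     = f Vec.[]
curryⁱ (suc n) f {X} = curryⁱ n (f ∘ (X ∷_))

tautology : ∀ n (φ : Schema n) → {T (allValuations n ⟦ φ ⟧ˢ)} →
            ∀ⁱ (λ σ → ⊢ instantiate σ φ)
tautology n φ {ok} = curryⁱ n λ σ → taut λ v →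
  trans (eval-instantiate v σ φ)
        (Equivalence.to T-≡ (allValuations-sound n ⟦ φ ⟧ˢ ok (Vec.map (eval v) σ)))

_⊣⊢_ : Formula → Formula → Set
A ⊣⊢ B = ⊢ A ⇔ B

infix 2 _⊣⊢_

mp₂ : ∀ {A B C} → ⊢ A ⇒ B ⇒ C → ⊢ A → ⊢ B → ⊢ C
mp₂ t p q = mp (mp t p) q

⇒-trans : ∀ {A B C} → ⊢ A ⇒ B → ⊢ B ⇒ C → ⊢ A ⇒ C
⇒-trans = mp₂ (tautology 3 ((x₀ ⇒ˢ x₁) ⇒ˢ (x₁ ⇒ˢ x₂) ⇒ˢ x₀ ⇒ˢ x₂))

⊣⊢-intro : ∀ {A B} → ⊢ A ⇒ B → ⊢ B ⇒ A → A ⊣⊢ B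
⊣⊢-intro = mp₂ (tautology 2 ((x₀ ⇒ˢ x₁) ⇒ˢ (x₁ ⇒ˢ x₀) ⇒ˢ (x₀ ⇔ˢ x₁)))

⊣⊢-to : ∀ {A B} → A ⊣⊢ B → ⊢ A ⇒ B
⊣⊢-to = mp (tautology 2 ((x₀ ⇔ˢ x₁) ⇒ˢ x₀ ⇒ˢ x₁))

⊣⊢-from : ∀ {A B} → A ⊣⊢ B → ⊢ B ⇒ A
⊣⊢-from = mp (tautology 2 ((x₀ ⇔ˢ x₁) ⇒ˢ x₁ ⇒ˢ x₀))

⊣⊢-refl : ∀ {A} → A ⊣⊢ A
⊣⊢-refl = tautology 1 (x₀ ⇔ˢ x₀)

⊣⊢-sym : ∀ {A B} → A ⊣⊢ B → B ⊣⊢ A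
⊣⊢-sym = mp (tautology 2 ((x₀ ⇔ˢ x₁) ⇒ˢ (x₁ ⇔ˢ x₀)))

⊣⊢-trans : ∀ {A B C} → A ⊣⊢ B → B ⊣⊢ C → A ⊣⊢ C
⊣⊢-trans = mp₂ (tautology 3 ((x₀ ⇔ˢ x₁) ⇒ˢ (x₁ ⇔ˢ x₂) ⇒ˢ (x₀ ⇔ˢ x₂)))

⊣⊢-theorems : ∀ {A B} → ⊢ A → ⊢ B → A ⊣⊢ B
⊣⊢-theorems = mp₂ (tautology 2 (x₀ ⇒ˢ x₁ ⇒ˢ (x₀ ⇔ˢ x₁)))

¬-cong : ∀ {A B} → A ⊣⊢ B → ¬' A ⊣⊢ ¬' B
¬-cong = mp (tautology 2 ((x₀ ⇔ˢ x₁) ⇒ˢ (¬ˢ x₀ ⇔ˢ ¬ˢ x₁)))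

⇒-cong : ∀ {A B C D} → A ⊣⊢ B → C ⊣⊢ D → (A ⇒ C) ⊣⊢ (B ⇒ D)
⇒-cong = mp₂ (tautology 4 ((x₀ ⇔ˢ x₁) ⇒ˢ (x₂ ⇔ˢ x₃) ⇒ˢ (x₀ ⇒ˢ x₂ ⇔ˢ x₁ ⇒ˢ x₃)))

∨-case : ∀ {A B C} → ⊢ A ⇒ C → ⊢ B ⇒ C → ⊢ (A ∨' B) ⇒ C
∨-case = mp₂ (tautology 3 ((x₀ ⇒ˢ x₂) ⇒ˢ (x₁ ⇒ˢ x₂) ⇒ˢ x₀ ∨ˢ x₁ ⇒ˢ x₂))

∧-cong : ∀ {A B C D} → A ⊣⊢ B → C ⊣⊢ D → (A ∧' C) ⊣⊢ (B ∧' D)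
∧-cong p q = ¬-cong (⇒-cong p (¬-cong q))

∨-cong : ∀ {A B C D} → A ⊣⊢ B → C ⊣⊢ D → (A ∨' C) ⊣⊢ (B ∨' D)
∨-cong p q = ⇒-cong (¬-cong p) q

-- S5 modal reasoning

□-mono : ∀ {A B} → ⊢ A ⇒ B → ⊢ □ A ⇒ □ B
□-mono p = mp ax-K (nec p)

□-mono₂ : ∀ {A B C} → ⊢ A ⇒ B ⇒ C → ⊢ □ A ⇒ □ B ⇒ □ C
□-mono₂ p = ⇒-trans (□-mono p) ax-K

□-cong : ∀ {A B} → A ⊣⊢ B → □ A ⊣⊢ □ B
□-cong p = ⊣⊢-intro (□-mono (⊣⊢-to p)) (□-mono (⊣⊢-from p))

□-⊤ : □ ⊤' ⊣⊢ ⊤'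
□-⊤ = ⊣⊢-theorems (nec (tautology 0 ⊤ˢ)) (tautology 0 ⊤ˢ)

□-distrib-∧ : ∀ {A B} → □ (A ∧' B) ⊣⊢ ((□ A) ∧' (□ B))
□-distrib-∧ = ⊣⊢-intro
  (mp₂ (tautology 3 ((x₀ ⇒ˢ x₁) ⇒ˢ (x₀ ⇒ˢ x₂) ⇒ˢ x₀ ⇒ˢ x₁ ∧ˢ x₂))
       (□-mono (tautology 2 (x₀ ∧ˢ x₁ ⇒ˢ x₀)))
       (□-mono (tautology 2 (x₀ ∧ˢ x₁ ⇒ˢ x₁))))
  (mp (tautology 3 ((x₀ ⇒ˢ x₁ ⇒ˢ x₂) ⇒ˢ x₀ ∧ˢ x₁ ⇒ˢ x₂))
      (□-mono₂ (tautology 2 (x₀ ⇒ˢ x₁ ⇒ˢ x₀ ∧ˢ x₁))))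

◇-⊥ : ◇ ⊥' ⊣⊢ ⊥'
◇-⊥ = mp (tautology 1 (x₀ ⇒ˢ (¬ˢ x₀ ⇔ˢ ⊥ˢ))) (nec (tautology 0 (¬ˢ ⊥ˢ)))

◇-distrib-∨ : ∀ {A B} → ◇ (A ∨' B) ⊣⊢ ((◇ A) ∨' (◇ B))
◇-distrib-∨ = ⊣⊢-trans
  (¬-cong (⊣⊢-trans (□-cong (tautology 2 (¬ˢ (x₀ ∨ˢ x₁) ⇔ˢ ¬ˢ x₀ ∧ˢ ¬ˢ x₁))) □-distrib-∧))
  (tautology 2 (¬ˢ (x₀ ∧ˢ x₁) ⇔ˢ ¬ˢ x₀ ∨ˢ ¬ˢ x₁))

□-4 : ∀ {A} → ⊢ □ A ⇒ □ (□ A)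
□-4 = ⇒-trans (mp (tautology 2 ((x₀ ⇒ˢ ¬ˢ x₁) ⇒ˢ x₁ ⇒ˢ ¬ˢ x₀)) ax-T)
     (⇒-trans ax-5 (□-mono (mp (tautology 2 ((¬ˢ x₀ ⇒ˢ x₁) ⇒ˢ ¬ˢ x₁ ⇒ˢ x₀)) ax-5)))

Rigid : Formula → Set
Rigid R = (⊢ R ⇒ □ R) × (⊢ ¬' R ⇒ □ (¬' R))

rigid-□ : ∀ {A} → Rigid (□ A)
rigid-□ = □-4 , ax-5

rigid-¬ : ∀ {R} → Rigid R → Rigid (¬' R)
rigid-¬ (R⇒□R , ¬R⇒□¬R) =
  ¬R⇒□¬R , ⇒-trans (mp (tautology 2 ((x₀ ⇒ˢ x₁) ⇒ˢ ¬ˢ ¬ˢ x₀ ⇒ˢ x₁)) R⇒□R)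
                    (□-mono (tautology 1 (x₀ ⇒ˢ ¬ˢ ¬ˢ x₀)))

rigid-∨ : ∀ {R S} → Rigid R → Rigid S → Rigid (R ∨' S)
rigid-∨ (R⇒□R , ¬R⇒□¬R) (S⇒□S , ¬S⇒□¬S) =
  ∨-case (⇒-trans R⇒□R (□-mono (tautology 2 (x₀ ⇒ˢ x₀ ∨ˢ x₁))))
         (⇒-trans S⇒□S (□-mono (tautology 2 (x₁ ⇒ˢ x₀ ∨ˢ x₁)))) ,
  ⇒-trans (mp₂ (tautology 4 ((¬ˢ x₀ ⇒ˢ x₂) ⇒ˢ (¬ˢ x₁ ⇒ˢ x₃) ⇒ˢ ¬ˢ (x₀ ∨ˢ x₁) ⇒ˢ x₂ ∧ˢ x₃))
               ¬R⇒□¬R ¬S⇒□¬S)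
          (⇒-trans (⊣⊢-from □-distrib-∧)
                   (□-mono (tautology 2 (¬ˢ x₀ ∧ˢ ¬ˢ x₁ ⇒ˢ ¬ˢ (x₀ ∨ˢ x₁)))))

rigid-⊥ : Rigid ⊥'
rigid-⊥ = tautology 1 (⊥ˢ ⇒ˢ x₀) , mp (tautology 1 (x₀ ⇒ˢ ¬ˢ ⊥ˢ ⇒ˢ x₀)) (nec (tautology 0 (¬ˢ ⊥ˢ)))

□-∨-rigid : ∀ {A R} → Rigid R → □ (A ∨' R) ⊣⊢ ((□ A) ∨' R)
□-∨-rigid (R⇒□R , ¬R⇒□¬R) = ⊣⊢-intro
  (mp₂ (tautology 4 ((¬ˢ x₀ ⇒ˢ x₁) ⇒ˢ (x₂ ⇒ˢ x₁ ⇒ˢ x₃) ⇒ˢ x₂ ⇒ˢ x₃ ∨ˢ x₀))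
       ¬R⇒□¬R (□-mono₂ (tautology 2 (x₀ ∨ˢ x₁ ⇒ˢ ¬ˢ x₁ ⇒ˢ x₀))))
  (∨-case (□-mono (tautology 2 (x₀ ⇒ˢ x₀ ∨ˢ x₁)))
          (⇒-trans R⇒□R (□-mono (tautology 2 (x₁ ⇒ˢ x₀ ∨ˢ x₁)))))

rn-self : ∀ x z → rn x x z ≡ z
rn-self x z = by-cases (z ≟ x)
  where
  by-cases : (d : Dec (z ≡ x)) → (if does d then x else z) ≡ z
  by-cases (yes z≡x) = sym z≡x
  by-cases (no _)    = refl

sub-self : ∀ x A → sub x x A ≡ A
sub-self x (pred P xs) = cong (pred P) (trans (map-cong (rn-self x) xs) (map-id xs))
sub-self x (u ≐ w)     = cong₂ _≐_ (rn-self x u) (rn-self x w)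
sub-self x (¬' A)      = cong ¬'_ (sub-self x A)
sub-self x (A ⇒ B)     = cong₂ _⇒_ (sub-self x A) (sub-self x B)
sub-self x (∀' z A)    = by-cases (z ≟ x)
  where
  by-cases : (d : Dec (z ≡ x)) → (if does d then ∀' z A else ∀' z (sub x x A)) ≡ ∀' z A
  by-cases (yes _) = refl
  by-cases (no _)  = cong (∀' z) (sub-self x A)
sub-self x (□ A)       = refl

admissible-self : ∀ x A → Admissible x x A
admissible-self x (pred _ _) = tt
admissible-self x (_ ≐ _)    = tt
admissible-self x (¬' A)     = admissible-self x A
admissible-self x (A ⇒ B)    = admissible-self x A , admissible-self x B
admissible-self x (∀' z A)   = (λ (x≢z , _) z≡x → x≢z (sym z≡x)) , admissible-self x A
admissible-self x (□ A)      = tt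

∀-elim : ∀ {x A} → ⊢ ∀' x A ⇒ A
∀-elim {x} {A} = subst (λ B → ⊢ ∀' x A ⇒ B) (sub-self x A) (ax-inst (admissible-self x A))

∀-gen : ∀ {x A} → ⊢ A → ⊢ ∀' x A
∀-gen p = mp ax-□∀ (nec p)

∀-intro : ∀ {x P A} → ¬ FreeIn x P → ⊢ P ⇒ A → ⊢ P ⇒ ∀' x A
∀-intro x∉P p = mp (ax-dist x∉P) (∀-gen p)

∀-bound : ∀ {x} A → ¬ FreeIn x (∀' x A)
∀-bound _ (x≢x , _) = x≢x refl

∀-mono : ∀ {x A B} → ⊢ A ⇒ B → ⊢ ∀' x A ⇒ ∀' x B
∀-mono {A = A} p = ∀-intro (∀-bound A) (⇒-trans ∀-elim p)

∀-cong : ∀ {x A B} → A ⊣⊢ B → ∀' x A ⊣⊢ ∀' x B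
∀-cong p = ⊣⊢-intro (∀-mono (⊣⊢-to p)) (∀-mono (⊣⊢-from p))

∀-⊤ : ∀ {x} → ∀' x ⊤' ⊣⊢ ⊤'
∀-⊤ = ⊣⊢-theorems (∀-gen (tautology 0 ⊤ˢ)) (tautology 0 ⊤ˢ)

∀-distrib-∧ : ∀ {x A B} → ∀' x (A ∧' B) ⊣⊢ ((∀' x A) ∧' (∀' x B))
∀-distrib-∧ {A = A} {B} = ⊣⊢-intro
  (mp₂ (tautology 3 ((x₀ ⇒ˢ x₁) ⇒ˢ (x₀ ⇒ˢ x₂) ⇒ˢ x₀ ⇒ˢ x₁ ∧ˢ x₂))
       (∀-mono (tautology 2 (x₀ ∧ˢ x₁ ⇒ˢ x₀)))
       (∀-mono (tautology 2 (x₀ ∧ˢ x₁ ⇒ˢ x₁))))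
  (∀-intro [ ∀-bound A , ∀-bound B ]′
           (mp₂ (tautology 4 ((x₀ ⇒ˢ x₁) ⇒ˢ (x₂ ⇒ˢ x₃) ⇒ˢ x₀ ∧ˢ x₂ ⇒ˢ x₁ ∧ˢ x₃)) ∀-elim ∀-elim))

∀-∨-closed : ∀ {x A R} → ¬ FreeIn x R → ∀' x (A ∨' R) ⊣⊢ ((∀' x A) ∨' R)
∀-∨-closed {A = A} {R} x∉R = ⊣⊢-intro
  (mp (tautology 3 ((x₀ ∧ˢ ¬ˢ x₁ ⇒ˢ x₂) ⇒ˢ x₀ ⇒ˢ x₂ ∨ˢ x₁))
      (∀-intro [ ∀-bound (A ∨' R) , x∉R ]′
               (mp (tautology 3 ((x₀ ⇒ˢ x₁ ∨ˢ x₂) ⇒ˢ x₀ ∧ˢ ¬ˢ x₂ ⇒ˢ x₁)) ∀-elim)))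
  (∀-intro [ ∀-bound A , x∉R ]′
           (mp (tautology 3 ((x₀ ⇒ˢ x₁) ⇒ˢ x₀ ∨ˢ x₂ ⇒ˢ x₁ ∨ˢ x₂)) ∀-elim))

-- Elementary disjunctions, read right-nested

open ElemDisj

AllBoxFree : List Formula → Set
AllBoxFree Cs = ∀ {C} → C ∈ Cs → BoxFree C

⊤'-boxFree : BoxFree ⊤'
⊤'-boxFree = tt , tt

⊥'-boxFree : BoxFree ⊥'
⊥'-boxFree = ⊤'-boxFree

□⋁ : List Formula → Formula
□⋁ []       = ⊥'
□⋁ (C ∷ Cs) = (□ C) ∨' □⋁ Cs

modalPart : ElemDisj → Formula
modalPart e = (◇ b e) ∨' □⋁ (cs e)

clause : ElemDisj → Formula
clause e = a e ∨' modalPart e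

⋀ : List ElemDisj → Formula
⋀ []       = ⊤'
⋀ (e ∷ es) = clause e ∧' ⋀ es

□⋁-++ : ∀ Cs Ds → □⋁ (Cs ++ Ds) ⊣⊢ (□⋁ Cs ∨' □⋁ Ds)
□⋁-++ []       Ds = tautology 1 (x₀ ⇔ˢ ⊥ˢ ∨ˢ x₀)
□⋁-++ (C ∷ Cs) Ds = ⊣⊢-trans (∨-cong ⊣⊢-refl (□⋁-++ Cs Ds))
                             (tautology 3 (x₀ ∨ˢ (x₁ ∨ˢ x₂) ⇔ˢ (x₀ ∨ˢ x₁) ∨ˢ x₂))

rigid-□⋁ : ∀ Cs → Rigid (□⋁ Cs)
rigid-□⋁ []       = rigid-⊥
rigid-□⋁ (C ∷ Cs) = rigid-∨ rigid-□ (rigid-□⋁ Cs)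

rigid-modalPart : ∀ e → Rigid (modalPart e)
rigid-modalPart e = rigid-∨ (rigid-¬ rigid-□) (rigid-□⋁ (cs e))

closed-□⋁ : ∀ {x} Cs → ¬ FreeIn x (□⋁ Cs)
closed-□⋁ []       (inj₁ ())
closed-□⋁ []       (inj₂ ())
closed-□⋁ (C ∷ Cs) (inj₂ x∈) = closed-□⋁ Cs x∈

closed-modalPart : ∀ {x} e → ¬ FreeIn x (modalPart e)
closed-modalPart e (inj₂ x∈) = closed-□⋁ (cs e) x∈

literal : (A : Formula) → BoxFree A → ElemDisj
literal A A-bf = record
  { a = A ; b = ⊥' ; cs = [] ; a-bf = A-bf ; b-bf = ⊥'-boxFree ; cs-bf = λ () }

possibility : (B : Formula) → BoxFree B → ElemDisj
possibility B B-bf = record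
  { a = ⊥' ; b = B ; cs = [] ; a-bf = ⊥'-boxFree ; b-bf = B-bf ; cs-bf = λ () }

necessity : (C : Formula) → BoxFree C → ElemDisj
necessity C C-bf = record
  { a = ⊥' ; b = ⊥' ; cs = C ∷ [] ; a-bf = ⊥'-boxFree ; b-bf = ⊥'-boxFree
  ; cs-bf = λ { (here refl) → C-bf } }

clause-literal : ∀ {A} A-bf → clause (literal A A-bf) ⊣⊢ A
clause-literal _ = ⊣⊢-trans (∨-cong ⊣⊢-refl (∨-cong ◇-⊥ ⊣⊢-refl))
                            (tautology 1 (x₀ ∨ˢ (⊥ˢ ∨ˢ ⊥ˢ) ⇔ˢ x₀))

clause-possibility : ∀ {B} B-bf → clause (possibility B B-bf) ⊣⊢ ◇ B
clause-possibility _ = tautology 1 (⊥ˢ ∨ˢ (x₀ ∨ˢ ⊥ˢ) ⇔ˢ x₀)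

clause-necessity : ∀ {C} C-bf → clause (necessity C C-bf) ⊣⊢ □ C
clause-necessity _ = ⊣⊢-trans (∨-cong ⊣⊢-refl (∨-cong ◇-⊥ ⊣⊢-refl))
                              (tautology 1 (⊥ˢ ∨ˢ (⊥ˢ ∨ˢ (x₀ ∨ˢ ⊥ˢ)) ⇔ˢ x₀))

⋀-literal : ∀ {A} A-bf → ⋀ (literal A A-bf ∷ []) ⊣⊢ A
⋀-literal A-bf = ⊣⊢-trans (tautology 1 (x₀ ∧ˢ ⊤ˢ ⇔ˢ x₀)) (clause-literal A-bf)

⋀-++ : ∀ es fs → ⋀ (es ++ fs) ⊣⊢ (⋀ es ∧' ⋀ fs)
⋀-++ []       fs = tautology 1 (x₀ ⇔ˢ ⊤ˢ ∧ˢ x₀)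
⋀-++ (e ∷ es) fs = ⊣⊢-trans (∧-cong ⊣⊢-refl (⋀-++ es fs))
                            (tautology 3 (x₀ ∧ˢ (x₁ ∧ˢ x₂) ⇔ˢ (x₀ ∧ˢ x₁) ∧ˢ x₂))

⋀-map : (F : Formula → Formula) (g : ElemDisj → ElemDisj) →
        F ⊤' ⊣⊢ ⊤' → (∀ {A B} → F (A ∧' B) ⊣⊢ (F A ∧' F B)) →
        (∀ e → F (clause e) ⊣⊢ clause (g e)) →
        ∀ es → F (⋀ es) ⊣⊢ ⋀ (map g es)
⋀-map F g F-⊤ F-∧ F-clause []       = F-⊤
⋀-map F g F-⊤ F-∧ F-clause (e ∷ es) =
  ⊣⊢-trans (F-∧ {clause e} {⋀ es}) (∧-cong (F-clause e) (⋀-map F g F-⊤ F-∧ F-clause es))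

-- The connectives on conjunctive forms

∀ᶜ : Var → ElemDisj → ElemDisj
∀ᶜ x e = record e { a = ∀' x (a e) ; a-bf = a-bf e }

□ᶜ : ElemDisj → ElemDisj
□ᶜ e = record
  { a = ⊥' ; b = b e ; cs = a e ∷ cs e ; a-bf = ⊥'-boxFree ; b-bf = b-bf e
  ; cs-bf = λ { (here refl) → a-bf e ; (there C∈) → cs-bf e C∈ } }

_∨ᶜ_ : ElemDisj → ElemDisj → ElemDisj
e ∨ᶜ f = record
  { a = a e ∨' a f ; b = b e ∨' b f ; cs = cs e ++ cs f
  ; a-bf = a-bf e , a-bf f ; b-bf = b-bf e , b-bf f
  ; cs-bf = λ C∈ → [ cs-bf e , cs-bf f ]′ (∈-++⁻ (cs e) C∈) }

∀-clause : ∀ x e → ∀' x (clause e) ⊣⊢ clause (∀ᶜ x e)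
∀-clause x e = ∀-∨-closed (closed-modalPart e)

□-clause : ∀ e → □ (clause e) ⊣⊢ clause (□ᶜ e)
□-clause e = ⊣⊢-trans (□-∨-rigid (rigid-modalPart e))
                      (tautology 3 (x₀ ∨ˢ (x₁ ∨ˢ x₂) ⇔ˢ ⊥ˢ ∨ˢ (x₁ ∨ˢ (x₀ ∨ˢ x₂))))

∨-clause : ∀ e f → (clause e ∨' clause f) ⊣⊢ clause (e ∨ᶜ f)
∨-clause e f = ⊣⊢-trans
  (tautology 6 ((x₀ ∨ˢ (x₂ ∨ˢ x₄)) ∨ˢ (x₁ ∨ˢ (x₃ ∨ˢ x₅))
                  ⇔ˢ (x₀ ∨ˢ x₁) ∨ˢ ((x₂ ∨ˢ x₃) ∨ˢ (x₄ ∨ˢ x₅))))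
  (∨-cong ⊣⊢-refl (⊣⊢-sym (∨-cong ◇-distrib-∨ (□⋁-++ (cs e) (cs f)))))

_∨ᴺ_ : List ElemDisj → List ElemDisj → List ElemDisj
_∨ᴺ_ = cartesianProductWith _∨ᶜ_

∨-clause-⋀ : ∀ e fs → (clause e ∨' ⋀ fs) ⊣⊢ ⋀ (map (e ∨ᶜ_) fs)
∨-clause-⋀ e []       = tautology 1 (x₀ ∨ˢ ⊤ˢ ⇔ˢ ⊤ˢ)
∨-clause-⋀ e (f ∷ fs) =
  ⊣⊢-trans (tautology 3 (x₀ ∨ˢ (x₁ ∧ˢ x₂) ⇔ˢ (x₀ ∨ˢ x₁) ∧ˢ (x₀ ∨ˢ x₂)))
           (∧-cong (∨-clause e f) (∨-clause-⋀ e fs))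

∨-⋀ : ∀ es fs → (⋀ es ∨' ⋀ fs) ⊣⊢ ⋀ (es ∨ᴺ fs)
∨-⋀ []       fs = tautology 1 (⊤ˢ ∨ˢ x₀ ⇔ˢ ⊤ˢ)
∨-⋀ (e ∷ es) fs =
  ⊣⊢-trans (tautology 3 ((x₀ ∧ˢ x₁) ∨ˢ x₂ ⇔ˢ (x₀ ∨ˢ x₂) ∧ˢ (x₁ ∨ˢ x₂)))
  (⊣⊢-trans (∧-cong (∨-clause-⋀ e fs) (∨-⋀ es fs))
            (⊣⊢-sym (⋀-++ (map (e ∨ᶜ_) fs) (es ∨ᴺ fs))))

¬□ᴺ : (Cs : List Formula) → AllBoxFree Cs → List ElemDisj
¬□ᴺ []       _     = []
¬□ᴺ (C ∷ Cs) Cs-bf = possibility (¬' C) (Cs-bf (here refl)) ∷ ¬□ᴺ Cs (Cs-bf ∘ there)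

¬ᶜ : ElemDisj → List ElemDisj
¬ᶜ e = literal (¬' a e) (a-bf e) ∷ necessity (¬' b e) (b-bf e) ∷ ¬□ᴺ (cs e) (cs-bf e)

¬ᴺ : List ElemDisj → List ElemDisj
¬ᴺ []       = literal ⊥' ⊥'-boxFree ∷ []
¬ᴺ (e ∷ es) = ¬ᶜ e ∨ᴺ ¬ᴺ es

¬-□⋁ : ∀ Cs (Cs-bf : AllBoxFree Cs) → ¬' □⋁ Cs ⊣⊢ ⋀ (¬□ᴺ Cs Cs-bf)
¬-□⋁ []       _     = tautology 0 (¬ˢ ⊥ˢ ⇔ˢ ⊤ˢ)
¬-□⋁ (C ∷ Cs) Cs-bf =
  ⊣⊢-trans (tautology 2 (¬ˢ (x₀ ∨ˢ x₁) ⇔ˢ ¬ˢ x₀ ∧ˢ ¬ˢ x₁))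
           (∧-cong (⊣⊢-trans (¬-cong (□-cong (tautology 1 (x₀ ⇔ˢ ¬ˢ ¬ˢ x₀))))
                             (⊣⊢-sym (clause-possibility (Cs-bf (here refl)))))
                   (¬-□⋁ Cs (Cs-bf ∘ there)))

¬-clause : ∀ e → ¬' clause e ⊣⊢ ⋀ (¬ᶜ e)
¬-clause e =
  ⊣⊢-trans (tautology 3 (¬ˢ (x₀ ∨ˢ (¬ˢ x₁ ∨ˢ x₂)) ⇔ˢ ¬ˢ x₀ ∧ˢ (x₁ ∧ˢ ¬ˢ x₂)))
           (∧-cong (⊣⊢-sym (clause-literal (a-bf e)))
                   (∧-cong (⊣⊢-sym (clause-necessity (b-bf e)))
                           (¬-□⋁ (cs e) (cs-bf e))))

¬-⋀ : ∀ es → ¬' ⋀ es ⊣⊢ ⋀ (¬ᴺ es)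
¬-⋀ []       = ⊣⊢-trans (tautology 0 (¬ˢ ⊤ˢ ⇔ˢ ⊥ˢ))
                        (⊣⊢-sym (⋀-literal ⊥'-boxFree))
¬-⋀ (e ∷ es) =
  ⊣⊢-trans (tautology 2 (¬ˢ (x₀ ∧ˢ x₁) ⇔ˢ ¬ˢ x₀ ∨ˢ ¬ˢ x₁))
  (⊣⊢-trans (∨-cong (¬-clause e) (¬-⋀ es)) (∨-⋀ (¬ᶜ e) (¬ᴺ es)))

cnf : Formula → List ElemDisj
cnf (pred P xs) = literal (pred P xs) tt ∷ []
cnf (x ≐ y)     = literal (x ≐ y) tt ∷ []
cnf (¬' A)      = ¬ᴺ (cnf A)
cnf (A ⇒ B)     = ¬ᴺ (cnf A) ∨ᴺ cnf B
cnf (∀' x A)    = map (∀ᶜ x) (cnf A)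
cnf (□ A)       = map □ᶜ (cnf A)

cnf-sound : ∀ A → A ⊣⊢ ⋀ (cnf A)
cnf-sound (pred P xs) = ⊣⊢-sym (⋀-literal tt)
cnf-sound (x ≐ y)     = ⊣⊢-sym (⋀-literal tt)
cnf-sound (¬' A)      = ⊣⊢-trans (¬-cong (cnf-sound A)) (¬-⋀ (cnf A))
cnf-sound (A ⇒ B)     =
  ⊣⊢-trans (tautology 2 (x₀ ⇒ˢ x₁ ⇔ˢ ¬ˢ x₀ ∨ˢ x₁))
  (⊣⊢-trans (∨-cong (⊣⊢-trans (¬-cong (cnf-sound A)) (¬-⋀ (cnf A))) (cnf-sound B))
            (∨-⋀ (¬ᴺ (cnf A)) (cnf B)))
cnf-sound (∀' x A)    =
  ⊣⊢-trans (∀-cong (cnf-sound A)) (⋀-map (∀' x) (∀ᶜ x) ∀-⊤ ∀-distrib-∧ (∀-clause x) (cnf A))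
cnf-sound (□ A)       =
  ⊣⊢-trans (□-cong (cnf-sound A)) (⋀-map □_ □ᶜ □-⊤ □-distrib-∧ □-clause (cnf A))

boxDisj-⊣⊢ : ∀ A Cs → boxDisj A Cs ⊣⊢ (A ∨' □⋁ Cs)
boxDisj-⊣⊢ A []       = tautology 1 (x₀ ⇔ˢ x₀ ∨ˢ ⊥ˢ)
boxDisj-⊣⊢ A (C ∷ Cs) = ⊣⊢-trans (boxDisj-⊣⊢ (A ∨' (□ C)) Cs)
                                 (tautology 3 ((x₀ ∨ˢ x₁) ∨ˢ x₂ ⇔ˢ x₀ ∨ˢ (x₁ ∨ˢ x₂)))

⟦⟧ᴱ-⊣⊢ : ∀ e → ⟦ e ⟧ᴱ ⊣⊢ clause e
⟦⟧ᴱ-⊣⊢ e = ⊣⊢-trans (boxDisj-⊣⊢ (a e ∨' (◇ b e)) (cs e))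
                    (tautology 3 ((x₀ ∨ˢ x₁) ∨ˢ x₂ ⇔ˢ x₀ ∨ˢ (x₁ ∨ˢ x₂)))

conj-⊣⊢ : ∀ A es → conj A es ⊣⊢ (A ∧' ⋀ es)
conj-⊣⊢ A []       = tautology 1 (x₀ ⇔ˢ x₀ ∧ˢ ⊤ˢ)
conj-⊣⊢ A (e ∷ es) =
  ⊣⊢-trans (conj-⊣⊢ (A ∧' ⟦ e ⟧ᴱ) es)
  (⊣⊢-trans (∧-cong (∧-cong ⊣⊢-refl (⟦⟧ᴱ-⊣⊢ e)) ⊣⊢-refl)
            (tautology 3 ((x₀ ∧ˢ x₁) ∧ˢ x₂ ⇔ˢ x₀ ∧ˢ (x₁ ∧ˢ x₂))))

toConjForm : List ElemDisj → ConjForm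
toConjForm []       = literal ⊤' ⊤'-boxFree ∷ []
toConjForm (e ∷ es) = e ∷ es

⋀-⊣⊢-⟦⟧ᶜ : ∀ es → ⋀ es ⊣⊢ ⟦ toConjForm es ⟧ᶜ
⋀-⊣⊢-⟦⟧ᶜ []       = ⊣⊢-sym (⊣⊢-trans (⟦⟧ᴱ-⊣⊢ (literal ⊤' ⊤'-boxFree)) (clause-literal ⊤'-boxFree))
⋀-⊣⊢-⟦⟧ᶜ (e ∷ es) = ⊣⊢-sym (⊣⊢-trans (conj-⊣⊢ ⟦ e ⟧ᴱ es) (∧-cong (⟦⟧ᴱ-⊣⊢ e) ⊣⊢-refl))

lemma5 : (A : Formula) → Σ ConjForm (λ F → FOL□ (A ⇔ ⟦ F ⟧ᶜ))
lemma5 A = toConjForm (cnf A) , ⊣⊢-trans (cnf-sound A) (⋀-⊣⊢-⟦⟧ᶜ (cnf A))
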